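{- Over functional frames (the logic PKF), both of the following hold: - $⌣p\wedge⌣q\models⌣(p\vee q)$; - $⌢(p\wedge q)\models⌢p\vee⌢q$.
   Context: Kripke semantics with classical local clauses for $\wedge,\vee$. The unary negative modalities are: - $w\Vdash ⌣\varphi$ iff $\varphi$ is false at some $R$-successor of $w$. - $w\Vdash ⌢\varphi$ iff $\varphi$ is false at every $R$-successor of $w$. PKF is the logic of frames whose accessibility relation is a total function. -}

module Defs where

open import Data.Nat using (ℕ)
open import Data.Bool using (Bool; true)
open import Data.Product using (Σ; _×_; _,_; ∃)
open import Data.Sum using (_⊎_)
open import Data.Empty using (⊥)
open import Relation.Nullary using (¬_)
open import Relation.Binary.PropositionalEquality using (_≡_)
open import Level using (0ℓ; suc)

data Form : Set where
  var  : ℕ → Form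
  _∧'_ : Form → Form → Form
  _∨'_ : Form → Form → Form
  ⌣_   : Form → Form
  ⌢_   : Form → Form

record Frame : Set₁ where
  field
    W : Set
    R : W → W → Set

Functional : Frame → Set
Functional F = ∀ w → Σ W λ v → R w v × (∀ u → R w u → u ≡ v)
  where open Frame F

record Model : Set₁ where
  field
    frame : Frame
    val   : ℕ → Frame.W frame → Bool
  open Frame frame public

_⊩_ : (M : Model) → Model.W M → Form → Set
_⊩_ M w (var n)   = Model.val M n w ≡ true
_⊩_ M w (φ ∧' ψ)  = (_⊩_ M w φ) × (_⊩_ M w ψ)
_⊩_ M w (φ ∨' ψ)  = (_⊩_ M w φ) ⊎ (_⊩_ M w ψ)
_⊩_ M w (⌣ φ)     = Σ (Model.W M) λ v → Model.R M w v × ¬ (_⊩_ M v φ)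
_⊩_ M w (⌢ φ)     = ∀ v → Model.R M w v → ¬ (_⊩_ M v φ)

_⊨PKF_ : Form → Form → Set₁
φ ⊨PKF ψ = ∀ (M : Model) → Functional (Model.frame M) →
           ∀ (w : Model.W M) → _⊩_ M w φ → _⊩_ M w ψ

-- On a functional frame every world w has exactly one successor v, so both ⌣φ and ⌢φ
-- hold at w exactly when φ fails at v.  Hence forcing is decidable, and each consequence
-- reduces to propositional reasoning about φ and ψ at v.
module Submission where

open import Defs
open import Data.Bool using (true)
open import Data.Bool.Properties using () renaming (_≟_ to _≟ᵇ_)
open import Data.Product using (_×_; _,_)
open import Data.Sum using (inj₁; inj₂)
open import Relation.Nullary using (¬_; Dec; yes; no)
open import Relation.Nullary.Decidable using (_×-dec_; _⊎-dec_)
open import Relation.Binary.PropositionalEquality using (_≡_; trans; sym; subst)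

module _ (M : Model) (functional : Functional (Model.frame M)) where
  open Model M

  infix 4 _⊩ᴹ_
  _⊩ᴹ_ : W → Form → Set
  w ⊩ᴹ φ = (M ⊩ w) φ

  successors-equal : ∀ {w u v} → R w u → R w v → u ≡ v
  successors-equal {w} Rwu Rwv with functional w
  ... | _ , _ , unique = trans (unique _ Rwu) (sym (unique _ Rwv))

  ⌣⇒⌢ : ∀ {w} φ → w ⊩ᴹ ⌣ φ → w ⊩ᴹ ⌢ φ
  ⌣⇒⌢ φ (v , Rwv , v⊮φ) u Rwu u⊩φ =
    v⊮φ (subst (_⊩ᴹ φ) (successors-equal Rwu Rwv) u⊩φ)

  ⊩-dec : ∀ w φ → Dec (w ⊩ᴹ φ)
  ⊩-dec w (var n)  = val n w ≟ᵇ true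
  ⊩-dec w (φ ∧' ψ) = ⊩-dec w φ ×-dec ⊩-dec w ψ
  ⊩-dec w (φ ∨' ψ) = ⊩-dec w φ ⊎-dec ⊩-dec w ψ
  ⊩-dec w (⌣ φ) with functional w
  ... | v , Rwv , _ with ⊩-dec v φ
  ...   | yes v⊩φ = no λ w⊩⌣φ → ⌣⇒⌢ φ w⊩⌣φ v Rwv v⊩φ
  ...   | no v⊮φ  = yes (v , Rwv , v⊮φ)
  ⊩-dec w (⌢ φ) with functional w
  ... | v , Rwv , _ with ⊩-dec v φ
  ...   | yes v⊩φ = no λ w⊩⌢φ → w⊩⌢φ v Rwv v⊩φ
  ...   | no v⊮φ  = yes (⌣⇒⌢ φ (v , Rwv , v⊮φ))

⌣∧⌣⊨⌣∨ : ∀ φ ψ → ((⌣ φ) ∧' (⌣ ψ)) ⊨PKF (⌣ (φ ∨' ψ))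
⌣∧⌣⊨⌣∨ φ ψ M functional w ((v , Rwv , v⊮φ) , w⊩⌣ψ) = v , Rwv , v⊮φ∨ψ
  where
  v⊮φ∨ψ : ¬ (M ⊩ v) (φ ∨' ψ)
  v⊮φ∨ψ (inj₁ v⊩φ) = v⊮φ v⊩φ
  v⊮φ∨ψ (inj₂ v⊩ψ) = ⌣⇒⌢ M functional ψ w⊩⌣ψ v Rwv v⊩ψ

⌢∧⊨⌢∨⌢ : ∀ φ ψ → (⌢ (φ ∧' ψ)) ⊨PKF ((⌢ φ) ∨' (⌢ ψ))
⌢∧⊨⌢∨⌢ φ ψ M functional w w⊩⌢φ∧ψ with functional w
... | v , Rwv , _ with ⊩-dec M functional v φ
...   | no v⊮φ  = inj₁ (⌣⇒⌢ M functional φ (v , Rwv , v⊮φ))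
...   | yes v⊩φ = inj₂ (⌣⇒⌢ M functional ψ (v , Rwv , λ v⊩ψ → w⊩⌢φ∧ψ v Rwv (v⊩φ , v⊩ψ)))

mainTheorem6 : (((⌣ var 0) ∧' (⌣ var 1)) ⊨PKF (⌣ (var 0 ∨' var 1)))
                 × ((⌢ (var 0 ∧' var 1)) ⊨PKF ((⌢ var 0) ∨' (⌢ var 1)))
mainTheorem6 = ⌣∧⌣⊨⌣∨ (var 0) (var 1) , ⌢∧⊨⌢∨⌢ (var 0) (var 1)
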